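{- Let $G$ be a graph without isolated vertices, let $Y$ be a uniform NFBDD realizing $\phi(G)$, and let $a$ be a non-leaf node of $Y$ having exactly one out-neighbour. Then the out-edge of $a$ is labelled by the positive literal of its variable.
   Context: $\phi(G)$ is the monotone 2-CNF with variables $\{x_v: v\in V(G)\}$ and clauses $(x_u\vee x_v)$ for $\{u,v\}\in E(G)$. An NROBP realizing $F$ is a connected DAG (multiple edges allowed) with one root and one leaf, some edges labelled by literals, no directed path containing two edges labelled by literals of the same variable; with $A(P)$ the literals on $P$, every extension of $A(P)$ for a root-to-leaf $P$ satisfies $F$ and every satisfying assignment contains some such $A(P)$. Uniform: paths from the root to the same node carry literals of the same variable set, and root-to-leaf paths carry literals of all variables. An NFBDD is an NROBP in which every edge is labelled, every node has out-degree at most $2$, and the two out-edges of a node of out-degree $2$ are labelled by opposite literals of the same variable. -}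

module Defs where

open import Data.Nat using (ℕ; zero; suc)
open import Data.Fin using (Fin)
open import Data.Bool using (Bool; true; false; not)
open import Data.Maybe using (Maybe; just; nothing)
open import Data.List using (List; []; _∷_; map; length)
open import Data.List.Membership.Propositional using (_∈_)
open import Data.List.Relation.Unary.All using (All)
open import Data.List.Relation.Unary.Unique.Propositional using (Unique)
open import Data.Product using (Σ; ∃; _×_; _,_; proj₁)
open import Data.Sum using (_⊎_)
open import Relation.Binary.PropositionalEquality using (_≡_; _≢_)
open import Relation.Nullary using (¬_)
open import Function.Bundles using (_⇔_)

record Graph (n : ℕ) : Set₁ where
  field
    Adj     : Fin n → Fin n → Set
    symm    : ∀ {u v} → Adj u v → Adj v u
    irrefl  : ∀ {v} → ¬ Adj v v

open Graph public

NoIsolatedVertices : ∀ {n} → Graph n → Set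
NoIsolatedVertices {n} G = ∀ (v : Fin n) → ∃ λ u → Adj G v u

-- (x , true) is the positive literal x, (x , false) the negative one ¬x
Lit : ℕ → Set
Lit n = Fin n × Bool

var : ∀ {n} → Lit n → Fin n
var = proj₁

Assignment : ℕ → Set
Assignment n = Fin n → Bool

Extends : ∀ {n} → Assignment n → List (Lit n) → Set
Extends σ ls = All (λ l → σ (proj₁ l) ≡ Data.Product.proj₂ l) ls

BoolFun : ℕ → Set₁
BoolFun n = Assignment n → Set

φ : ∀ {n} → Graph n → BoolFun n
φ G σ = ∀ u v → Adj G u v → (σ u ≡ true) ⊎ (σ v ≡ true)

record Diagram (n : ℕ) : Set where
  field
    nodes  : ℕ
    edges  : ℕ
    src    : Fin edges → Fin nodes
    tgt    : Fin edges → Fin nodes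
    lab    : Fin edges → Maybe (Lit n)
    root   : Fin nodes
    leaf   : Fin nodes

module _ {n : ℕ} (D : Diagram n) where
  open Diagram D

  data Path : Fin nodes → Fin nodes → Set where
    []   : ∀ {a} → Path a a
    step : ∀ {a b} (e : Fin edges) → src e ≡ a → Path (tgt e) b → Path a b

  pathLength : ∀ {a b} → Path a b → ℕ
  pathLength []           = zero
  pathLength (step _ _ p) = suc (pathLength p)

  consM : ∀ {A : Set} → Maybe A → List A → List A
  consM (just x) xs = x ∷ xs
  consM nothing  xs = xs

  literals : ∀ {a b} → Path a b → List (Lit n)
  literals []           = []
  literals (step e _ p) = consM (lab e) (literals p)

  vars : ∀ {a b} → Path a b → List (Fin n)
  vars p = map var (literals p)

  data UWalk : Fin nodes → Fin nodes → Set where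
    []   : ∀ {a} → UWalk a a
    fwd  : ∀ {a b} (e : Fin edges) → src e ≡ a → UWalk (tgt e) b → UWalk a b
    bwd  : ∀ {a b} (e : Fin edges) → tgt e ≡ a → UWalk (src e) b → UWalk a b

  Connected : Set
  Connected = ∀ a b → UWalk a b

  Acyclic : Set
  Acyclic = ∀ a (p : Path a a) → pathLength p ≡ zero

  UniqueRoot : Set
  UniqueRoot = ∀ v → ((∀ e → tgt e ≢ v) ⇔ (v ≡ root))

  UniqueLeaf : Set
  UniqueLeaf = ∀ v → ((∀ e → src e ≢ v) ⇔ (v ≡ leaf))

  ReadOnce : Set
  ReadOnce = ∀ a b (p : Path a b) → Unique (vars p)

  record IsNROBP : Set where
    field
      connected  : Connected
      acyclic    : Acyclic
      uniqueRoot : UniqueRoot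
      uniqueLeaf : UniqueLeaf
      readOnce   : ReadOnce

  Realizes : BoolFun n → Set
  Realizes F =
    (∀ (p : Path root leaf) (σ : Assignment n) → Extends σ (literals p) → F σ)
    × (∀ (σ : Assignment n) → F σ → Σ (Path root leaf) λ p → Extends σ (literals p))

  Uniform : Set
  Uniform =
    (∀ v (p q : Path root v) (x : Fin n) → (x ∈ vars p) ⇔ (x ∈ vars q))
    × (∀ (p : Path root leaf) (x : Fin n) → x ∈ vars p)

  AllLabelled : Set
  AllLabelled = ∀ e → ∃ λ (l : Lit n) → lab e ≡ just l

  OutDegreeAtMost2 : Set
  OutDegreeAtMost2 = ∀ e₁ e₂ e₃ → src e₁ ≡ src e₂ → src e₂ ≡ src e₃ →
    (e₁ ≡ e₂) ⊎ (e₁ ≡ e₃) ⊎ (e₂ ≡ e₃)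

  OppositeOutEdges : Set
  OppositeOutEdges = ∀ e₁ e₂ → e₁ ≢ e₂ → src e₁ ≡ src e₂ →
    ∃ λ (x : Fin n) → ∃ λ (b : Bool) →
      (lab e₁ ≡ just (x , b)) × (lab e₂ ≡ just (x , not b))

  record IsNFBDD : Set where
    field
      nrobp       : IsNROBP
      labelled    : AllLabelled
      outDeg≤2    : OutDegreeAtMost2
      opposite    : OppositeOutEdges

-- Suppose the only out-edge e of a is labelled ¬x. Following a path from the root to a, then e,
-- then on to the leaf gives a satisfying assignment σ₀ with σ₀ x = false, and x is not read
-- before a. By monotonicity σ₀ with x flipped to true is still a model, so some root-to-leaf path
-- Q is consistent with it. An NFBDD is deterministic on consistent paths, so Q runs through a
-- and must then take e, whose label ¬x is now violated.
module Submission where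

open import Defs
open import Data.Nat using (ℕ)
open import Data.Fin using (Fin)
open import Data.Bool using (true)
open import Data.Maybe using (just)
open import Data.Product using (∃; _,_)
open import Relation.Binary.PropositionalEquality using (_≡_; _≢_)

open import Data.Nat using (zero; suc; _+_; _≤_; s≤s)
open import Data.Nat.Properties using (+-suc; +-identityʳ; 1+n≰n; 0≢1+n; ≮⇒≥)
open import Data.Fin as Fin using (_≟_)
open import Data.Fin.Properties using (¬∀⟶∃¬; pigeonhole)
open import Data.Bool using (false)
open import Data.Bool.Properties using (not-¬)
open import Data.Maybe using (Maybe; nothing)
open import Data.List using (List; []; _∷_; _++_; length; map; lookup)
open import Data.List.Properties using (map-++)
open import Data.List.Membership.Propositional using (_∈_; _∉_)
import Data.List.Membership.DecPropositional as DecMembership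
open import Data.List.Membership.Propositional.Properties using (∈-lookup; ∈-++⁺ʳ)
open import Data.List.Relation.Unary.Any using (here; there)
open import Data.List.Relation.Unary.All as All using (All; []; _∷_)
open import Data.List.Relation.Unary.All.Properties using (¬Any⇒All¬; ++⁻ˡ; map⁻)
open import Data.List.Relation.Unary.AllPairs using ([]; _∷_)
open import Data.List.Relation.Unary.Unique.Propositional using (Unique)
open import Data.List.Relation.Unary.Unique.Propositional.Properties using (Unique[x∷xs]⇒x∉xs)
open import Data.Vec.Functional using (updateAt)
open import Data.Vec.Functional.Properties using (updateAt-updates; updateAt-minimal)
open import Data.Product using (Σ; proj₂)
open import Data.Sum using (_⊎_; inj₁; inj₂; [_,_]′)
open import Data.Empty using (⊥; ⊥-elim)
open import Function using (_∘_; const)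
open import Function.Bundles using (Equivalence)
open import Relation.Nullary using (¬_; yes; no)
open import Relation.Nullary.Decidable using (¬?; decidable-stable)
open import Relation.Binary.PropositionalEquality using (refl; sym; trans; cong; subst; module ≡-Reasoning)

Unique-lookup-injective : ∀ {A : Set} {xs : List A} → Unique xs →
  ∀ {i j} → i Fin.< j → lookup xs i ≢ lookup xs j
Unique-lookup-injective (x∉ ∷ _) {Fin.zero} {Fin.suc j} _ = All.lookup x∉ (∈-lookup j)
Unique-lookup-injective (_ ∷ u) {Fin.suc i} {Fin.suc j} (s≤s i<j) =
  Unique-lookup-injective u i<j

Unique⇒length≤ : ∀ {N} {xs : List (Fin N)} → Unique xs → length xs ≤ N
Unique⇒length≤ {xs = xs} u = ≮⇒≥ λ N<length →
  let (_ , _ , i<j , same) = pigeonhole N<length (lookup xs)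
  in Unique-lookup-injective u i<j same

Unique[xs++x∷ys]⇒x∉xs : ∀ {A : Set} (xs : List A) {x ys} → Unique (xs ++ x ∷ ys) → x ∉ xs
Unique[xs++x∷ys]⇒x∉xs (_ ∷ xs) (y∉ ∷ _) (here refl) = All.lookup y∉ (∈-++⁺ʳ xs (here refl)) refl
Unique[xs++x∷ys]⇒x∉xs (_ ∷ xs) (_ ∷ u) (there x∈xs) = Unique[xs++x∷ys]⇒x∉xs xs u x∈xs

¬∀≢⇒∃≡ : ∀ {m N} (h : Fin m → Fin N) {c} → ¬ (∀ i → h i ≢ c) → ∃ λ i → h i ≡ c
¬∀≢⇒∃≡ {m} h {c} ¬∀ =
  let (i , ¬≢) = ¬∀⟶∃¬ m (λ i → h i ≢ c) (λ i → ¬? (h i ≟ c)) ¬∀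
  in i , decidable-stable (h i ≟ c) ¬≢

module _ {n : ℕ} {D : Diagram n} where
  open Diagram D

  infixr 5 _++ₚ_
  _++ₚ_ : ∀ {a b c} → Path D a b → Path D b c → Path D a c
  [] ++ₚ q = q
  step e e↦a p ++ₚ q = step e e↦a (p ++ₚ q)

  pathLength-++ : ∀ {a b c} (p : Path D a b) (q : Path D b c) →
    pathLength D (p ++ₚ q) ≡ pathLength D p + pathLength D q
  pathLength-++ [] q = refl
  pathLength-++ (step e _ p) q = cong suc (pathLength-++ p q)

  consM-++ : ∀ {A : Set} (m : Maybe A) xs ys → consM D m xs ++ ys ≡ consM D m (xs ++ ys)
  consM-++ (just x) xs ys = refl
  consM-++ nothing  xs ys = refl

  literals-++ : ∀ {a b c} (p : Path D a b) (q : Path D b c) →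
    literals D (p ++ₚ q) ≡ literals D p ++ literals D q
  literals-++ [] q = refl
  literals-++ (step e _ p) q =
    trans (cong (consM D (lab e)) (literals-++ p q))
          (sym (consM-++ (lab e) (literals D p) (literals D q)))

  vars-++ : ∀ {a b c} (p : Path D a b) (q : Path D b c) →
    vars D (p ++ₚ q) ≡ vars D p ++ vars D q
  vars-++ p q = trans (cong (map var) (literals-++ p q)) (map-++ var (literals D p) (literals D q))

  nodesOf : ∀ {a b} → Path D a b → List (Fin nodes)
  nodesOf {a} []           = a ∷ []
  nodesOf {a} (step _ _ p) = a ∷ nodesOf p

  prefixTo : ∀ {a b c} (p : Path D a b) → c ∈ nodesOf p → Path D a c
  prefixTo []             (here refl) = []
  prefixTo (step _ _ _)   (here refl) = []
  prefixTo (step e e↦a p) (there c∈p) = step e e↦a (prefixTo p c∈p)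

  path-from-sink : ∀ {v b} → (∀ e → src e ≢ v) → Path D v b → v ≡ b
  path-from-sink _    []             = refl
  path-from-sink sink (step e e↦v _) = ⊥-elim (sink e e↦v)

  -- Going backwards from t along in-edges never revisits a node (that would close a cycle),
  -- so by pigeonhole it reaches s within `nodes` steps.
  reachable-from : Acyclic D → ∀ s → (∀ c → c ≢ s → ∃ λ e → tgt e ≡ c) → ∀ t → Path D s t
  reachable-from acyclic s in-edge t = extend nodes [] ([] ∷ []) refl
    where
    extend : ∀ {c} (fuel : ℕ) (p : Path D c t) → Unique (nodesOf p) →
      length (nodesOf p) + fuel ≡ suc nodes → Path D s t
    extend zero p u len =
      ⊥-elim (1+n≰n (subst (_≤ nodes) (trans (sym (+-identityʳ _)) len) (Unique⇒length≤ u)))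
    extend {c} (suc fuel) p u len with c ≟ s
    ... | yes refl = p
    ... | no c≢s with in-edge c c≢s
    ... | e , refl with DecMembership._∈?_ _≟_ (src e) (nodesOf p)
    ... | yes src∈p = ⊥-elim (0≢1+n (sym (acyclic (src e) (step e refl (prefixTo p src∈p)))))
    ... | no src∉p =
      extend fuel (step e refl p) (¬Any⇒All¬ _ src∉p ∷ u) (trans (sym (+-suc _ fuel)) len)

_ᵒᵖ : ∀ {n} → Diagram n → Diagram n
D ᵒᵖ = record
  { nodes = nodes ; edges = edges ; src = tgt ; tgt = src ; lab = lab
  ; root = leaf ; leaf = root }
  where open Diagram D

module _ {n : ℕ} {D : Diagram n} where
  open Diagram D

  unopPath : ∀ {a b} → Path (D ᵒᵖ) a b → Path D b a
  unopPath []             = []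
  unopPath (step e refl p) = unopPath p ++ₚ step e refl []

  pathLength-unop : ∀ {a b} (p : Path (D ᵒᵖ) a b) → pathLength D (unopPath p) ≡ pathLength (D ᵒᵖ) p
  pathLength-unop [] = refl
  pathLength-unop (step e refl p) = begin
    pathLength D (unopPath p ++ₚ step e refl [])  ≡⟨ pathLength-++ (unopPath p) _ ⟩
    pathLength D (unopPath p) + 1                ≡⟨ +-suc _ 0 ⟩
    suc (pathLength D (unopPath p) + 0)          ≡⟨ cong suc (+-identityʳ _) ⟩
    suc (pathLength D (unopPath p))              ≡⟨ cong suc (pathLength-unop p) ⟩
    suc (pathLength (D ᵒᵖ) p)                    ∎
    where open ≡-Reasoning

  ᵒᵖ-acyclic : Acyclic D → Acyclic (D ᵒᵖ)
  ᵒᵖ-acyclic acyclic a p = trans (sym (pathLength-unop p)) (acyclic a (unopPath p))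

  reaching : Acyclic D → ∀ t → (∀ c → c ≢ t → ∃ λ e → src e ≡ c) → ∀ s → Path D s t
  reaching acyclic t out-edge s =
    unopPath (reachable-from {D = D ᵒᵖ} (ᵒᵖ-acyclic acyclic) t out-edge s)

module _ {n : ℕ} where

  _≤ₐ_ : Assignment n → Assignment n → Set
  σ ≤ₐ τ = ∀ x → σ x ≡ true → τ x ≡ true

  Monotone : BoolFun n → Set
  Monotone F = ∀ {σ τ} → σ ≤ₐ τ → F σ → F τ

  ≤ₐ-set-true : ∀ (σ : Assignment n) x → σ ≤ₐ updateAt σ x (const true)
  ≤ₐ-set-true σ x y σy with y ≟ x
  ... | yes refl = updateAt-updates x σ
  ... | no y≢x   = trans (updateAt-minimal y x σ y≢x) σy

  updateAt-preserves-Extends : ∀ {σ : Assignment n} {x f ls} → x ∉ map var ls →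
    Extends σ ls → Extends (updateAt σ x f) ls
  updateAt-preserves-Extends {σ} {x} x∉ls σls = All.zipWith
    (λ (x≢ , σl) → trans (updateAt-minimal _ x σ (x≢ ∘ sym)) σl)
    (map⁻ (¬Any⇒All¬ _ x∉ls) , σls)

  assignmentOf : List (Lit n) → Assignment n
  assignmentOf []            = const true
  assignmentOf ((x , b) ∷ ls) = updateAt (assignmentOf ls) x (const b)

  assignmentOf-extends : ∀ ls → Unique (map var ls) → Extends (assignmentOf ls) ls
  assignmentOf-extends []             _          = []
  assignmentOf-extends ((x , b) ∷ ls) (x∉ ∷ u) =
    updateAt-updates x (assignmentOf ls)
    ∷ updateAt-preserves-Extends (Unique[x∷xs]⇒x∉xs (x∉ ∷ u)) (assignmentOf-extends ls u)

φ-monotone : ∀ {n} (G : Graph n) → Monotone (φ G)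
φ-monotone G σ≤τ φσ u v uv with φσ u v uv
... | inj₁ σu = inj₁ (σ≤τ u σu)
... | inj₂ σv = inj₂ (σ≤τ v σv)

module _ {n : ℕ} (D : Diagram n) where
  open Diagram D

  ConsistentPath : Assignment n → Fin nodes → Fin nodes → Set
  ConsistentPath σ a b = Σ (Path D a b) λ p → Extends σ (literals D p)

  Extends-head : ∀ {σ : Assignment n} {m l ls} → m ≡ just l →
    Extends σ (consM D m ls) → σ (var l) ≡ proj₂ l
  Extends-head refl (σl ∷ _) = σl

  Extends-tail : ∀ {σ : Assignment n} m {ls} → Extends σ (consM D m ls) → Extends σ ls
  Extends-tail (just _) (_ ∷ σls) = σls
  Extends-tail nothing  σls       = σls

  -- Out-edges of a common node carry opposite literals, so two consistent paths from the same
  -- node cannot branch: one of them is an initial segment of the other.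
  consistent-paths-comparable : OppositeOutEdges D → ∀ {σ a b c} →
    ConsistentPath σ a b → ConsistentPath σ a c → ConsistentPath σ b c ⊎ ConsistentPath σ c b
  consistent-paths-comparable opp {σ} (p , σp) (q , σq) = comparable p σp q σq
    where
    comparable : ∀ {a b c} (p : Path D a b) → Extends σ (literals D p) →
      (q : Path D a c) → Extends σ (literals D q) → ConsistentPath σ b c ⊎ ConsistentPath σ c b
    comparable [] _ q σq = inj₁ (q , σq)
    comparable p σp [] _ = inj₂ (p , σp)
    comparable (step e e↦a p) σp (step f f↦a q) σq with e ≟ f
    ... | yes refl = comparable p (Extends-tail (lab e) σp) q (Extends-tail (lab e) σq)
    ... | no e≢f with opp e f e≢f (trans e↦a (sym f↦a))
    ... | _ , _ , lab-e , lab-f = ⊥-elim (not-¬ (Extends-head lab-e σp) (Extends-head lab-f σq))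

sole-out-edge-not-negative : ∀ {n} {F : BoolFun n} (Y : Diagram n) → IsNFBDD Y →
  Realizes Y F → Monotone F →
  ∀ {a} → a ≢ Diagram.leaf Y →
  ∀ {e} → Diagram.src Y e ≡ a → (∀ e′ → Diagram.src Y e′ ≡ a → e′ ≡ e) →
  ∀ x → Diagram.lab Y e ≢ just (x , false)
sole-out-edge-not-negative {n} {F} Y nfbdd (sound , complete) monotone {a} a≢leaf {e} e↦a sole x lab-e =
  [ blocked a≢leaf
  , (λ (leaf⇝a , _) → a≢leaf (sym (path-from-sink leaf-is-sink leaf⇝a)))
  ]′ (consistent-paths-comparable Y opposite (P₁ , σP₁) (complete σ Fσ))
  where
  open Diagram Y
  open IsNFBDD nfbdd
  open IsNROBP nrobp

  in-edge : ∀ c → c ≢ root → ∃ λ f → tgt f ≡ c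
  in-edge c c≢root = ¬∀≢⇒∃≡ tgt (c≢root ∘ Equivalence.to (uniqueRoot c))

  out-edge : ∀ c → c ≢ leaf → ∃ λ f → src f ≡ c
  out-edge c c≢leaf = ¬∀≢⇒∃≡ src (c≢leaf ∘ Equivalence.to (uniqueLeaf c))

  leaf-is-sink : ∀ f → src f ≢ leaf
  leaf-is-sink = Equivalence.from (uniqueLeaf leaf) refl

  P₁ : Path Y root a
  P₁ = reachable-from acyclic root in-edge a

  a⇝leaf : Path Y a leaf
  a⇝leaf = reaching acyclic leaf out-edge a

  P₂ : Path Y (tgt e) leaf
  P₂ with a⇝leaf
  ... | [] = ⊥-elim (a≢leaf refl)
  ... | step f f↦a p with sole f f↦a
  ... | refl = p

  P : Path Y root leaf
  P = P₁ ++ₚ step e e↦a P₂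

  vars-P : vars Y P ≡ vars Y P₁ ++ x ∷ vars Y P₂
  vars-P = begin
    vars Y P                                                ≡⟨ vars-++ P₁ (step e e↦a P₂) ⟩
    vars Y P₁ ++ map var (consM Y (lab e) (literals Y P₂))  ≡⟨ cong (λ m → vars Y P₁ ++ map var (consM Y m (literals Y P₂))) lab-e ⟩
    vars Y P₁ ++ x ∷ vars Y P₂                              ∎
    where open ≡-Reasoning

  σ₀ : Assignment n
  σ₀ = assignmentOf (literals Y P)

  σ₀P : Extends σ₀ (literals Y P)
  σ₀P = assignmentOf-extends (literals Y P) (readOnce root leaf P)

  σ : Assignment n
  σ = updateAt σ₀ x (const true)

  Fσ : F σ
  Fσ = monotone (≤ₐ-set-true σ₀ x) (sound P σ₀ σ₀P)

  σP₁ : Extends σ (literals Y P₁)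
  σP₁ = updateAt-preserves-Extends
    (Unique[xs++x∷ys]⇒x∉xs (vars Y P₁) (subst Unique vars-P (readOnce root leaf P)))
    (++⁻ˡ (literals Y P₁) (subst (Extends σ₀) (literals-++ P₁ _) σ₀P))

  blocked : ∀ {d} → a ≢ d → ConsistentPath Y σ a d → ⊥
  blocked a≢d ([] , _) = a≢d refl
  blocked _ (step f f↦a _ , σf) with sole f f↦a
  ... | refl with trans (sym (updateAt-updates x σ₀)) (Extends-head Y lab-e σf)
  ... | ()

lemma5 : ∀ {n : ℕ} (G : Graph n) → NoIsolatedVertices G →
    (Y : Diagram n) → IsNFBDD Y → Uniform Y → Realizes Y (φ G) →
    (a : Fin (Diagram.nodes Y)) → a ≢ Diagram.leaf Y →
    (e : Fin (Diagram.edges Y)) → Diagram.src Y e ≡ a →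
    (∀ e′ → Diagram.src Y e′ ≡ a → e′ ≡ e) →
    ∃ λ (x : Fin n) → Diagram.lab Y e ≡ just (x , true)
-- Only the monotonicity of φ(G) is needed: the isolated-vertex and uniformity hypotheses are unused.
lemma5 G _ Y nfbdd _ realizes a a≢leaf e e↦a sole with IsNFBDD.labelled nfbdd e
... | (x , true)  , lab-e = x , lab-e
... | (x , false) , lab-e =
  ⊥-elim (sole-out-edge-not-negative Y nfbdd realizes (φ-monotone G) a≢leaf e↦a sole x lab-e)
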